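{- Let $D$ be the derivation on $\mathbb{Q}[a,b,x,y,z]$ determined by $D(a)=az$, $D(b)=xy$, $D(x)=xy$, $D(y)=xy$, $D(z)=xy$ (extended by linearity and the Leibniz rule). For $n\ge1$ let $P_n(x,z)=\sum_{\sigma\in S_n}x^{\mathrm{asc}(\sigma)}z^{\mathrm{suc}(\sigma)}$. Then for every $n\ge 1$, $$P_n(x,z)=D^{n-1}(ab)\big|_{a=1,\ y=1,\ b=x,\ z=xz}.$$
   Context: $S_n$ is the set of permutations $\sigma=\sigma_1\cdots\sigma_n$ of $[n]$, with $\sigma_0=0$. $\mathrm{asc}(\sigma)$ is the number of indices $0\le i\le n-1$ with $\sigma_i<\sigma_{i+1}$; $\mathrm{suc}(\sigma)$ is the number of indices $1\le i\le n-1$ with $\sigma_i+1=\sigma_{i+1}$. The substitution $z=xz$ means replacing the variable $z$ by the product $xz$ (simultaneously with the other substitutions). -}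

module Defs where

open import Data.Nat as ℕ using (ℕ; zero; suc; _∸_)
open import Data.Fin using (Fin; zero; suc)
open import Data.Vec as Vec using (Vec; []; _∷_; lookup; replicate; zipWith; updateAt; tabulate)
open import Data.Vec.Properties using (≡-dec)
open import Data.List as List using (List; []; _∷_; _++_; map; concatMap; foldr; concat)
open import Data.Product using (_×_; _,_)
open import Data.Bool using (Bool; true; false; if_then_else_)
open import Data.Rational as ℚ using (ℚ; 0ℚ; 1ℚ)
open import Relation.Nullary using (does)
open import Function using (_∘_)
open import Data.Integer using (+_)

-- Polynomials over ℚ in k variables (variables indexed by Fin k),
-- represented as finite formal sums of terms  c · X^m.
-- Two polynomials are equal iff all their coefficients agree (coeff).

Mono : ℕ → Set
Mono k = Vec ℕ k

Poly : ℕ → Set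
Poly k = List (ℚ × Mono k)

coeff : ∀ {k} → Poly k → Mono k → ℚ
coeff [] m = 0ℚ
coeff ((c , m′) ∷ p) m =
  if does (≡-dec ℕ._≟_ m′ m) then c ℚ.+ coeff p m else coeff p m

_+P_ : ∀ {k} → Poly k → Poly k → Poly k
p +P q = p ++ q

scaleP : ∀ {k} → ℚ → Poly k → Poly k
scaleP c = map (λ { (d , m) → (c ℚ.* d , m) })

_*P_ : ∀ {k} → Poly k → Poly k → Poly k
p *P q = concatMap (λ { (c , m) → map (λ { (d , m′) → (c ℚ.* d , zipWith ℕ._+_ m m′) }) q }) p

oneP : ∀ {k} → Poly k
oneP = (1ℚ , replicate _ 0) ∷ []

varP : ∀ {k} → Fin k → Poly k
varP i = (1ℚ , updateAt (replicate _ 0) i (λ _ → 1)) ∷ []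

_^P_ : ∀ {k} → Poly k → ℕ → Poly k
p ^P zero  = oneP
p ^P suc n = p *P (p ^P n)

monoP : ∀ {k} → Mono k → Poly k
monoP m = (1ℚ , m) ∷ []

derivMono : ∀ {k} → (Fin k → Poly k) → Mono k → Poly k
derivMono {k} g m =
  concat (List.map (λ i → scaleP ((+ lookup m i ℚ./ 1))
                           (monoP (updateAt m i (λ e → e ∸ 1)) *P g i))
                   (List.allFin k))

derivP : ∀ {k} → (Fin k → Poly k) → Poly k → Poly k
derivP g = concatMap (λ { (c , m) → scaleP c (derivMono g m) })

iterateP : ∀ {k} → (Poly k → Poly k) → ℕ → Poly k → Poly k
iterateP f zero    p = p
iterateP f (suc n) p = f (iterateP f n p)

substMono : ∀ {k l} → (Fin k → Poly l) → Mono k → Poly l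
substMono {k} s m = foldr (λ i acc → (s i ^P lookup m i) *P acc) oneP (List.allFin k)

substP : ∀ {k l} → (Fin k → Poly l) → Poly k → Poly l
substP s = concatMap (λ { (c , m) → scaleP c (substMono s m) })

-- Q[a,b,x,y,z] : variables indexed a = 0, b = 1, x = 2, y = 3, z = 4.

vA vB vX vY vZ : Poly 5
vA = varP zero
vB = varP (suc zero)
vX = varP (suc (suc zero))
vY = varP (suc (suc (suc zero)))
vZ = varP (suc (suc (suc (suc zero))))

Dgen : Fin 5 → Poly 5
Dgen zero                         = vA *P vZ
Dgen (suc zero)                   = vX *P vY
Dgen (suc (suc zero))             = vX *P vY
Dgen (suc (suc (suc zero)))       = vX *P vY
Dgen (suc (suc (suc (suc zero)))) = vX *P vY

D : Poly 5 → Poly 5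
D = derivP Dgen

-- Q[x,z] : variables indexed x = 0, z = 1.
wX wZ : Poly 2
wX = varP zero
wZ = varP (suc zero)

specialise : Fin 5 → Poly 2
specialise zero                         = oneP
specialise (suc zero)                   = wX
specialise (suc (suc zero))             = wX
specialise (suc (suc (suc zero)))       = oneP
specialise (suc (suc (suc (suc zero)))) = wX *P wZ

-- Permutations of [n] as words σ₁⋯σₙ (lists of naturals).

insertions : ℕ → List ℕ → List (List ℕ)
insertions x []       = (x ∷ []) ∷ []
insertions x (y ∷ ys) = (x ∷ y ∷ ys) ∷ map (y ∷_) (insertions x ys)

S : ℕ → List (List ℕ)
S zero    = [] ∷ []
S (suc n) = concatMap (insertions (suc n)) (S n)

countAsc : List ℕ → ℕ → ℕ
countAsc []       _ = 0
countAsc (y ∷ ys) x = (if does (x ℕ.<? y) then 1 else 0) ℕ.+ countAsc ys y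

-- asc σ, with the convention σ₀ = 0 (indices 0 ≤ i ≤ n-1)
asc : List ℕ → ℕ
asc σ = countAsc σ 0

countSuc : List ℕ → ℕ → ℕ
countSuc []       _ = 0
countSuc (y ∷ ys) x = (if does (suc x ℕ.≟ y) then 1 else 0) ℕ.+ countSuc ys y

sucs : List ℕ → ℕ
sucs []       = 0
sucs (y ∷ ys) = countSuc ys y

Pn : ℕ → Poly 2
Pn n = map (λ σ → (1ℚ , asc σ ∷ sucs σ ∷ [])) (S n)

-- Pair a polynomial p with a function h on exponent vectors: ⟨ h ⟩ p = Σ c · h m over the terms
-- c X^m of p. Coefficients, the substitution a = 1, y = 1, b = x, z = x z and the derivation D
-- all act on such pairings: since every D(X_i) is a monomial X^(γ i), ⟨ h ⟩ (D p) = ⟨ Dᵀ h ⟩ p with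
-- Dᵀ h m = Σ_i m_i · h (m - e_i + γ i).
--
-- On the combinatorial side, label the gaps of 0 σ₁ ⋯ σₙ 0 (a grammatical labelling):
-- 𝑎 after the maximum, 𝑏 for the initial ascent 0 → 1, 𝑧 for the other successions, 𝑥 for the
-- other ascents and 𝑦 for descents and the end. Inserting n + 1 into a gap labelled 𝑎 turns that
-- 𝑎 into 𝑧 𝑎; inserting it into any other gap turns that label into 𝑥 𝑎 while the old maximum's 𝑎
-- becomes 𝑦. On the multiset of labels this is exactly the Leibniz term of D = (a ↦ a z, else ↦ x y)
-- at that letter, so by induction Σ_{σ ∈ S_{n+1}} H (labels of σ) = (Dᵀ)ⁿ H (a b) for every H.
-- Specialising a = y = 1, b = x, z = x z sends the labels of σ to x^asc(σ) z^suc(σ).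

module Submission where

open import Defs
open import Algebra.Bundles using (CommutativeMonoid)
import Algebra.Properties.CommutativeSemigroup as CommSemigroupProperties
import Algebra.Solver.CommutativeMonoid as CommMonoidSolver
open import Data.Bool using (true; false; if_then_else_; _∧_)
open import Data.Bool.Properties using (∧-zeroʳ)
open import Data.Fin using (Fin; zero; suc)
open import Data.Fin.Patterns using (0F; 1F; 2F; 3F)
import Data.Integer as ℤ
import Data.Integer.Tactic.RingSolver as ℤSolver
open import Data.List using (List; []; _∷_; _++_; map; concatMap; foldr; allFin)
import Data.List.Properties as Listₚ
open import Data.List.Relation.Unary.All as All using (All; []; _∷_)
import Data.List.Relation.Unary.All.Properties as Allₚ
open import Data.Nat as ℕ using (ℕ; zero; suc; _∸_; _≤_; _<_; _≟_; _<?_; s≤s; z≤n)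
import Data.Nat.Properties as ℕₚ
import Data.Nat.Tactic.RingSolver as ℕSolver
open import Data.Product using (_×_; _,_; proj₁; proj₂)
open import Data.Rational as ℚ using (ℚ; 0ℚ; 1ℚ; _+_; _*_; _/_)
import Data.Rational.Properties as ℚₚ
import Data.Rational.Unnormalised as ℚᵘ
import Data.Rational.Unnormalised.Properties as ℚᵘₚ
open import Data.Vec using ([]; _∷_; lookup; replicate; zipWith; updateAt)
import Data.Vec.Properties as Vecₚ
open import Function using (_∘_; id)
open import Level using (0ℓ)
open import Relation.Nullary using (does; yes; no)
open import Relation.Nullary.Decidable using (dec-true; dec-false)
open import Relation.Binary.PropositionalEquality

private
  variable
    k l : ℕ
    A B : Set

∑ : (A → ℚ) → List A → ℚ
∑ f []       = 0ℚ
∑ f (a ∷ as) = f a + ∑ f as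

∑-++ : ∀ (f : A → ℚ) xs ys → ∑ f (xs ++ ys) ≡ ∑ f xs + ∑ f ys
∑-++ f []       ys = sym (ℚₚ.+-identityˡ _)
∑-++ f (x ∷ xs) ys = trans (cong (f x +_) (∑-++ f xs ys)) (sym (ℚₚ.+-assoc (f x) _ _))

∑-cong-All : ∀ {f g : A → ℚ} {xs} → All (λ a → f a ≡ g a) xs → ∑ f xs ≡ ∑ g xs
∑-cong-All []       = refl
∑-cong-All (e ∷ es) = cong₂ _+_ e (∑-cong-All es)

∑-cong : ∀ {f g : A → ℚ} → (∀ a → f a ≡ g a) → ∀ xs → ∑ f xs ≡ ∑ g xs
∑-cong f≗g xs = ∑-cong-All (All.universal f≗g xs)

∑-*ˡ : ∀ c (f : A → ℚ) xs → ∑ (λ a → c * f a) xs ≡ c * ∑ f xs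
∑-*ˡ c f []       = sym (ℚₚ.*-zeroʳ c)
∑-*ˡ c f (x ∷ xs) = trans (cong (c * f x +_) (∑-*ˡ c f xs)) (sym (ℚₚ.*-distribˡ-+ c (f x) _))

∑-map : ∀ (f : B → ℚ) (g : A → B) xs → ∑ f (map g xs) ≡ ∑ (f ∘ g) xs
∑-map f g []       = refl
∑-map f g (x ∷ xs) = cong (f (g x) +_) (∑-map f g xs)

∑-concatMap : ∀ (f : B → ℚ) (g : A → List B) xs → ∑ f (concatMap g xs) ≡ ∑ (∑ f ∘ g) xs
∑-concatMap f g []       = refl
∑-concatMap f g (x ∷ xs) =
  trans (∑-++ f (g x) (concatMap g xs)) (cong (∑ f (g x) +_) (∑-concatMap f g xs))

∑-allFin-suc : ∀ (f : Fin (suc k) → ℚ) → ∑ f (allFin (suc k)) ≡ f zero + ∑ (f ∘ suc) (allFin k)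
∑-allFin-suc {k} f =
  cong (f zero +_) (trans (cong (∑ f) (sym (Listₚ.map-tabulate id suc))) (∑-map f suc (allFin k)))

_⊕_ : Mono k → Mono k → Mono k
_⊕_ = zipWith ℕ._+_

infixr 6 _⊕_

0ᵐ : Mono k
0ᵐ = replicate _ 0

𝟙 : Fin k → Mono k
𝟙 i = updateAt 0ᵐ i (λ _ → 1)

_×ᵐ_ : ℕ → Mono k → Mono k
zero  ×ᵐ m = 0ᵐ
suc n ×ᵐ m = m ⊕ n ×ᵐ m

lowerAt : Mono k → Fin k → Mono k
lowerAt m i = updateAt m i (_∸ 1)

count : List (Fin k) → Mono k
count = foldr (λ i w → 𝟙 i ⊕ w) 0ᵐ

⊕-0ᵐ-commutativeMonoid : ℕ → CommutativeMonoid 0ℓ 0ℓ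
⊕-0ᵐ-commutativeMonoid k = record
  { Carrier = Mono k ; _≈_ = _≡_ ; _∙_ = _⊕_ ; ε = 0ᵐ
  ; isCommutativeMonoid = record
    { isMonoid = record
      { isSemigroup = record
        { isMagma = record { isEquivalence = isEquivalence ; ∙-cong = cong₂ _⊕_ }
        ; assoc = Vecₚ.zipWith-assoc ℕₚ.+-assoc }
      ; identity = Vecₚ.zipWith-identityˡ ℕₚ.+-identityˡ , Vecₚ.zipWith-identityʳ ℕₚ.+-identityʳ }
    ; comm = Vecₚ.zipWith-comm ℕₚ.+-comm } }

module ⊕ {k} = CommutativeMonoid (⊕-0ᵐ-commutativeMonoid k)
open module ⊕-Properties {k} = CommSemigroupProperties (⊕.commutativeSemigroup {k})
  using (x∙yz≈y∙xz; xy∙z≈xz∙y)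

⊕-shift : ∀ {u u′ s t : Mono k} w → u ⊕ s ≡ u′ ⊕ t → (u ⊕ w) ⊕ s ≡ (u′ ⊕ w) ⊕ t
⊕-shift {u = u} {u′} {s} {t} w eq = begin
  (u ⊕ w) ⊕ s   ≡⟨ xy∙z≈xz∙y u w s ⟩
  (u ⊕ s) ⊕ w   ≡⟨ cong (_⊕ w) eq ⟩
  (u′ ⊕ t) ⊕ w  ≡⟨ xy∙z≈xz∙y u′ t w ⟩
  (u′ ⊕ w) ⊕ t  ∎
  where open ≡-Reasoning

lowerAt-𝟙⊕ : ∀ (i : Fin k) w → lowerAt (𝟙 i ⊕ w) i ≡ w
lowerAt-𝟙⊕ zero    (w₀ ∷ w) = cong (w₀ ∷_) (⊕.identityˡ w)
lowerAt-𝟙⊕ (suc i) (w₀ ∷ w) = cong (w₀ ∷_) (lowerAt-𝟙⊕ i w)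

⟨_⟩ : (Mono k → ℚ) → Poly k → ℚ
⟨ h ⟩ = ∑ (λ (c , m) → c * h m)

δ : Mono k → Mono k → ℚ
δ m m′ = if does (Vecₚ.≡-dec ℕ._≟_ m′ m) then 1ℚ else 0ℚ

coeff≡⟨δ⟩ : ∀ (p : Poly k) m → coeff p m ≡ ⟨ δ m ⟩ p
coeff≡⟨δ⟩ []             m = refl
coeff≡⟨δ⟩ ((c , m′) ∷ p) m with does (Vecₚ.≡-dec ℕ._≟_ m′ m)
... | true  = cong₂ _+_ (sym (ℚₚ.*-identityʳ c)) (coeff≡⟨δ⟩ p m)
... | false = trans (coeff≡⟨δ⟩ p m)
                    (trans (sym (ℚₚ.+-identityˡ _)) (cong (_+ ⟨ δ m ⟩ p) (sym (ℚₚ.*-zeroʳ c))))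

⟨⟩-map : ∀ (h : Mono l → ℚ) c (φ : Mono k → Mono l) (f : ℚ × Mono k → ℚ × Mono l) →
         (∀ d m → f (d , m) ≡ (c * d , φ m)) → ∀ p → ⟨ h ⟩ (map f p) ≡ c * ⟨ h ∘ φ ⟩ p
⟨⟩-map h c φ f f-def p = begin
  ⟨ h ⟩ (map f p)                             ≡⟨ ∑-map _ f p ⟩
  ∑ (λ t → proj₁ (f t) * h (proj₂ (f t))) p
    ≡⟨ ∑-cong (λ (d , m) → trans (cong (λ (e , m′) → e * h m′) (f-def d m))
                                  (ℚₚ.*-assoc c d (h (φ m)))) p ⟩
  ∑ (λ (d , m) → c * (d * h (φ m))) p         ≡⟨ ∑-*ˡ c _ p ⟩
  c * ⟨ h ∘ φ ⟩ p                             ∎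
  where open ≡-Reasoning

⟨⟩-scaleP : ∀ (h : Mono k → ℚ) c p → ⟨ h ⟩ (scaleP c p) ≡ c * ⟨ h ⟩ p
⟨⟩-scaleP h c = ⟨⟩-map h c id _ (λ _ _ → refl)

⟨⟩-*P : ∀ (h : Mono k → ℚ) p q → ⟨ h ⟩ (p *P q) ≡ ⟨ (λ m → ⟨ h ∘ (m ⊕_) ⟩ q) ⟩ p
⟨⟩-*P h p q =
  trans (∑-concatMap _ _ p) (∑-cong (λ (c , m) → ⟨⟩-map h c (m ⊕_) _ (λ _ _ → refl) q) p)

⟨⟩-extend : ∀ (h : Mono l → ℚ) (F : Mono k → Poly l) (f : ℚ × Mono k → Poly l) →
            (∀ c m → f (c , m) ≡ scaleP c (F m)) → ∀ p → ⟨ h ⟩ (concatMap f p) ≡ ⟨ ⟨ h ⟩ ∘ F ⟩ p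
⟨⟩-extend h F f f-def p =
  trans (∑-concatMap _ f p)
        (∑-cong (λ (c , m) → trans (cong ⟨ h ⟩ (f-def c m)) (⟨⟩-scaleP h c (F m))) p)

record IsMonomial (p : Poly k) (m : Mono k) : Set where
  constructor isMonomial
  field ⟨⟩-eval : ∀ h → ⟨ h ⟩ p ≡ h m
open IsMonomial

monoP-isMonomial : ∀ (m : Mono k) → IsMonomial (monoP m) m
monoP-isMonomial m = isMonomial λ h → trans (ℚₚ.+-identityʳ _) (ℚₚ.*-identityˡ (h m))

varP-isMonomial : ∀ (i : Fin k) → IsMonomial (varP i) (𝟙 i)
varP-isMonomial i = monoP-isMonomial (𝟙 i)

*P-isMonomial : ∀ {p q : Poly k} {m m′} → IsMonomial p m → IsMonomial q m′ → IsMonomial (p *P q) (m ⊕ m′)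
*P-isMonomial {p = p} {q} p≅m q≅m′ =
  isMonomial λ h → trans (⟨⟩-*P h p q) (trans (⟨⟩-eval p≅m _) (⟨⟩-eval q≅m′ _))

^P-isMonomial : ∀ {p : Poly k} {m} → IsMonomial p m → ∀ n → IsMonomial (p ^P n) (n ×ᵐ m)
^P-isMonomial p≅m zero    = monoP-isMonomial 0ᵐ
^P-isMonomial p≅m (suc n) = *P-isMonomial p≅m (^P-isMonomial p≅m n)

substExp : (Fin k → Mono l) → Mono k → Mono l
substExp μ m = foldr (λ i e → lookup m i ×ᵐ μ i ⊕ e) 0ᵐ (allFin _)

substMono-isMonomial : ∀ {s : Fin k → Poly l} {μ : Fin k → Mono l} → (∀ i → IsMonomial (s i) (μ i)) →
                       ∀ m → IsMonomial (substMono s m) (substExp μ m)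
substMono-isMonomial {s = s} {μ} s≅μ m = foldr-isMonomial (allFin _)
  where
  foldr-isMonomial : ∀ is → IsMonomial (foldr (λ i acc → (s i ^P lookup m i) *P acc) oneP is)
                                       (foldr (λ i e → lookup m i ×ᵐ μ i ⊕ e) 0ᵐ is)
  foldr-isMonomial []       = monoP-isMonomial 0ᵐ
  foldr-isMonomial (i ∷ is) = *P-isMonomial (^P-isMonomial (s≅μ i) (lookup m i)) (foldr-isMonomial is)

-- Transposed derivations

derivᵀ : (Fin k → Poly k) → (Mono k → ℚ) → Mono k → ℚ
derivᵀ g h m = ⟨ h ⟩ (derivMono g m)

iterateᵀ : (Fin k → Poly k) → ℕ → (Mono k → ℚ) → Mono k → ℚ
iterateᵀ g zero    h = h
iterateᵀ g (suc n) h = iterateᵀ g n (derivᵀ g h)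

⟨⟩-iterateP : ∀ (g : Fin k → Poly k) n h p → ⟨ h ⟩ (iterateP (derivP g) n p) ≡ ⟨ iterateᵀ g n h ⟩ p
⟨⟩-iterateP g zero    h p = refl
⟨⟩-iterateP g (suc n) h p =
  trans (⟨⟩-extend h (derivMono g) _ (λ _ _ → refl) (iterateP (derivP g) n p))
        (⟨⟩-iterateP g n (derivᵀ g h) p)

fromℕ : ℕ → ℚ
fromℕ n = ℤ.+ n / 1

fromℕ-suc : ∀ n → fromℕ (suc n) ≡ 1ℚ + fromℕ n
fromℕ-suc n = ℚₚ.toℚᵘ-injective (begin
  ℚ.toℚᵘ (fromℕ (suc n))                    ≈⟨ ℚₚ.toℚᵘ-fromℚᵘ (ℚᵘ.mkℚᵘ (ℤ.+ suc n) 0) ⟩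
  ℚᵘ.mkℚᵘ (ℤ.+ suc n) 0                     ≈⟨ ℚᵘ.*≡* (cross-multiplied (ℤ.+ n)) ⟩
  ℚᵘ.mkℚᵘ (ℤ.+ 1) 0 ℚᵘ.+ ℚᵘ.mkℚᵘ (ℤ.+ n) 0
    ≈⟨ ℚᵘₚ.+-cong (ℚₚ.toℚᵘ-fromℚᵘ (ℚᵘ.mkℚᵘ (ℤ.+ 1) 0)) (ℚₚ.toℚᵘ-fromℚᵘ (ℚᵘ.mkℚᵘ (ℤ.+ n) 0)) ⟨
  ℚ.toℚᵘ 1ℚ ℚᵘ.+ ℚ.toℚᵘ (fromℕ n)           ≈⟨ ℚₚ.toℚᵘ-homo-+ 1ℚ (fromℕ n) ⟨
  ℚ.toℚᵘ (1ℚ + fromℕ n)                     ∎)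
  where
  open ℚᵘₚ.≃-Reasoning
  cross-multiplied : ∀ i → (ℤ.+ 1 ℤ.+ i) ℤ.* (ℤ.+ 1 ℤ.* ℤ.+ 1) ≡ (ℤ.+ 1 ℤ.* ℤ.+ 1 ℤ.+ i ℤ.* ℤ.+ 1) ℤ.* ℤ.+ 1
  cross-multiplied = ℤSolver.solve-∀

weightedSum : Mono k → (Fin k → ℚ) → ℚ
weightedSum w F = ∑ (λ i → fromℕ (lookup w i) * F i) (allFin _)

weightedSum-∷ : ∀ w₀ (w : Mono k) F → weightedSum (w₀ ∷ w) F ≡ fromℕ w₀ * F zero + weightedSum w (F ∘ suc)
weightedSum-∷ w₀ w F = ∑-allFin-suc (λ i → fromℕ (lookup (w₀ ∷ w) i) * F i)

weightedSum-0ᵐ : ∀ (F : Fin k → ℚ) → weightedSum 0ᵐ F ≡ 0ℚ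
weightedSum-0ᵐ {zero}  F = refl
weightedSum-0ᵐ {suc k} F = begin
  weightedSum 0ᵐ F                          ≡⟨ weightedSum-∷ 0 0ᵐ F ⟩
  0ℚ * F zero + weightedSum 0ᵐ (F ∘ suc)   ≡⟨ cong₂ _+_ (ℚₚ.*-zeroˡ (F zero)) (weightedSum-0ᵐ (F ∘ suc)) ⟩
  0ℚ + 0ℚ                                  ≡⟨ ℚₚ.+-identityˡ 0ℚ ⟩
  0ℚ                                       ∎
  where open ≡-Reasoning

weightedSum-𝟙⊕ : ∀ (i : Fin k) w F → weightedSum (𝟙 i ⊕ w) F ≡ F i + weightedSum w F
weightedSum-𝟙⊕ {suc k} zero (w₀ ∷ w) F = begin
  weightedSum (𝟙 zero ⊕ (w₀ ∷ w)) F                         ≡⟨ weightedSum-∷ (suc w₀) (0ᵐ ⊕ w) F ⟩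
  fromℕ (suc w₀) * F zero + weightedSum (0ᵐ ⊕ w) (F ∘ suc)
    ≡⟨ cong₂ (λ a v → a * F zero + weightedSum v (F ∘ suc)) (fromℕ-suc w₀) (⊕.identityˡ w) ⟩
  (1ℚ + fromℕ w₀) * F zero + weightedSum w (F ∘ suc)
    ≡⟨ cong (_+ weightedSum w (F ∘ suc)) (trans (ℚₚ.*-distribʳ-+ (F zero) 1ℚ (fromℕ w₀))
                                               (cong (_+ fromℕ w₀ * F zero) (ℚₚ.*-identityˡ (F zero)))) ⟩
  (F zero + fromℕ w₀ * F zero) + weightedSum w (F ∘ suc)  ≡⟨ ℚₚ.+-assoc (F zero) _ _ ⟩
  F zero + (fromℕ w₀ * F zero + weightedSum w (F ∘ suc))  ≡⟨ cong (F zero +_) (weightedSum-∷ w₀ w F) ⟨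
  F zero + weightedSum (w₀ ∷ w) F                         ∎
  where open ≡-Reasoning
weightedSum-𝟙⊕ {suc k} (suc i) (w₀ ∷ w) F = begin
  weightedSum (𝟙 (suc i) ⊕ (w₀ ∷ w)) F                       ≡⟨ weightedSum-∷ w₀ (𝟙 i ⊕ w) F ⟩
  fromℕ w₀ * F zero + weightedSum (𝟙 i ⊕ w) (F ∘ suc)
    ≡⟨ cong (fromℕ w₀ * F zero +_) (weightedSum-𝟙⊕ i w (F ∘ suc)) ⟩
  fromℕ w₀ * F zero + (F (suc i) + weightedSum w (F ∘ suc))
    ≡⟨ CommSemigroupProperties.x∙yz≈y∙xz ℚ-+-commutativeSemigroup (fromℕ w₀ * F zero) (F (suc i)) _ ⟩
  F (suc i) + (fromℕ w₀ * F zero + weightedSum w (F ∘ suc))  ≡⟨ cong (F (suc i) +_) (weightedSum-∷ w₀ w F) ⟨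
  F (suc i) + weightedSum (w₀ ∷ w) F                         ∎
  where
  open ≡-Reasoning
  ℚ-+-commutativeSemigroup = CommutativeMonoid.commutativeSemigroup ℚₚ.+-0-commutativeMonoid

∑-count : ∀ (F : Fin k → ℚ) G → ∑ F G ≡ weightedSum (count G) F
∑-count F []      = sym (weightedSum-0ᵐ F)
∑-count F (i ∷ G) = trans (cong (F i +_) (∑-count F G)) (sym (weightedSum-𝟙⊕ i (count G) F))

derivᵀ-monomial : ∀ {g : Fin k → Poly k} {γ : Fin k → Mono k} → (∀ i → IsMonomial (g i) (γ i)) →
                  ∀ h m → derivᵀ g h m ≡ weightedSum m (λ i → h (lowerAt m i ⊕ γ i))
derivᵀ-monomial {g = g} {γ} g≅γ h m = trans (∑-concatMap _ term (allFin _)) (∑-cong ⟨h⟩-term (allFin _))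
  where
  term : Fin _ → Poly _
  term i = scaleP (fromℕ (lookup m i)) (monoP (lowerAt m i) *P g i)
  ⟨h⟩-term : ∀ i → ⟨ h ⟩ (term i) ≡ fromℕ (lookup m i) * h (lowerAt m i ⊕ γ i)
  ⟨h⟩-term i = trans (⟨⟩-scaleP h (fromℕ (lookup m i)) (monoP (lowerAt m i) *P g i))
    (cong (fromℕ (lookup m i) *_) (⟨⟩-eval (*P-isMonomial (monoP-isMonomial (lowerAt m i)) (g≅γ i)) h))

derivᵀ-count : ∀ {g : Fin k → Poly k} {γ : Fin k → Mono k} → (∀ i → IsMonomial (g i) (γ i)) →
               ∀ h G → derivᵀ g h (count G) ≡ ∑ (λ i → h (lowerAt (count G) i ⊕ γ i)) G
derivᵀ-count {γ = γ} g≅γ h G =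
  trans (derivᵀ-monomial g≅γ h (count G)) (sym (∑-count (λ i → h (lowerAt (count G) i ⊕ γ i)) G))

-- The derivation D and the gap labels

pattern 𝑎 = zero
pattern 𝑏 = suc zero
pattern 𝑥 = suc (suc zero)
pattern 𝑦 = suc (suc (suc zero))
pattern 𝑧 = suc (suc (suc (suc zero)))

Dexp : Fin 5 → Mono 5
Dexp 𝑎       = 𝟙 𝑎 ⊕ 𝟙 𝑧
Dexp (suc _) = 𝟙 𝑥 ⊕ 𝟙 𝑦

Dgen-isMonomial : ∀ i → IsMonomial (Dgen i) (Dexp i)
Dgen-isMonomial 𝑎 = *P-isMonomial (varP-isMonomial 𝑎) (varP-isMonomial 𝑧)
Dgen-isMonomial 𝑏 = *P-isMonomial (varP-isMonomial 𝑥) (varP-isMonomial 𝑦)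
Dgen-isMonomial 𝑥 = *P-isMonomial (varP-isMonomial 𝑥) (varP-isMonomial 𝑦)
Dgen-isMonomial 𝑦 = *P-isMonomial (varP-isMonomial 𝑥) (varP-isMonomial 𝑦)
Dgen-isMonomial 𝑧 = *P-isMonomial (varP-isMonomial 𝑥) (varP-isMonomial 𝑦)

leibniz : Mono 5 → Fin 5 → Mono 5
leibniz w i = lowerAt w i ⊕ Dexp i

leibniz-𝟙⊕ : ∀ v i w → leibniz (v ⊕ 𝟙 i ⊕ w) i ≡ (v ⊕ w) ⊕ Dexp i
leibniz-𝟙⊕ v i w =
  cong (_⊕ Dexp i) (trans (cong (λ u → lowerAt u i) (x∙yz≈y∙xz v (𝟙 i) w)) (lowerAt-𝟙⊕ i (v ⊕ w)))

-- Label of the gap p q when p is not the maximum; 0F, 1F, 2F, 3F stand for 𝑏, 𝑥, 𝑦, 𝑧 (apply suc).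
gapLabel : ℕ → ℕ → Fin 4
gapLabel p q = if does (p ≟ 0) ∧ does (q ≟ 1) then 0F
               else if does (suc p ≟ q) then 3F
               else if does (p <? q) then 1F
               else 2F

label : ℕ → ℕ → ℕ → Fin 5
label M p q = if does (p ≟ M) then 𝑎 else suc (gapLabel p q)

head₀ : List ℕ → ℕ
head₀ []      = 0
head₀ (q ∷ _) = q

-- gaps M p σ labels the gaps of p σ₁ ⋯ σₙ 0, where M is the maximum and the final 0 a sentinel.
gaps : ℕ → ℕ → List ℕ → List (Fin 5)
gapsFrom : ℕ → List ℕ → List (Fin 5)
gaps M p qs = label M p (head₀ qs) ∷ gapsFrom M qs
gapsFrom M []       = []
gapsFrom M (q ∷ qs) = gaps M q qs

weight : ℕ → List ℕ → Mono 5
weight M σ = count (gaps M 0 σ)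

label-max : ∀ M q → label M M q ≡ 𝑎
label-max M q rewrite dec-true (M ≟ M) refl = refl

label-below : ∀ {M p} q → p ≢ M → label M p q ≡ suc (gapLabel p q)
label-below {M} {p} q p≢M rewrite dec-false (p ≟ M) p≢M = refl

gapLabel-𝑥 : ∀ {p q} → p < q → suc p ≢ q → gapLabel p q ≡ 1F
gapLabel-𝑥 {p} {q} p<q 1+p≢q
  rewrite dec-false (q ≟ 1) (ℕₚ.>⇒≢ (ℕₚ.≤-trans (s≤s (s≤s z≤n)) (ℕₚ.≤∧≢⇒< p<q 1+p≢q)))
        | ∧-zeroʳ (does (p ≟ 0)) | dec-false (suc p ≟ q) 1+p≢q | dec-true (p <? q) p<q = refl

gapLabel-𝑦 : ∀ {p q} → q ≤ p → gapLabel p q ≡ 2F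
gapLabel-𝑦 {zero}      z≤n = refl
gapLabel-𝑦 {suc p} {q} q≤p
  rewrite dec-false (suc (suc p) ≟ q) (λ e → ℕₚ.<⇒≱ (ℕₚ.≤-reflexive e) q≤p)
        | dec-false (suc p <? q) (ℕₚ.≤⇒≯ q≤p) = refl

gapLabel-𝑧 : ∀ {p} → 0 < p → gapLabel p (suc p) ≡ 3F
gapLabel-𝑧 {p} 0<p rewrite dec-false (p ≟ 0) (ℕₚ.>⇒≢ 0<p) | dec-true (suc p ≟ suc p) refl = refl

-- Inserting a new maximum

data UniqueMax (N : ℕ) : List ℕ → Set where
  here  : ∀ {ys} → All (_< N) ys → UniqueMax N (N ∷ ys)
  there : ∀ {y ys} → y < N → UniqueMax N ys → UniqueMax N (y ∷ ys)

head₀-< : ∀ {N ys} → 0 < N → All (_< N) ys → head₀ ys < N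
head₀-< 0<N []        = 0<N
head₀-< 0<N (q<N ∷ _) = q<N

module InsertMax (N : ℕ) (1≤N : 1 ≤ N) where

  open CommMonoidSolver (⊕-0ᵐ-commutativeMonoid 5) using (solve; _⊜_) renaming (_⊕_ to _⊕ᵉ_)

  label-new-below : ∀ {p} q → p < N → label (suc N) p q ≡ label N p q
  label-new-below q p<N =
    trans (label-below q (ℕₚ.<⇒≢ (ℕₚ.m<n⇒m<1+n p<N))) (sym (label-below q (ℕₚ.<⇒≢ p<N)))

  label-new-𝑥 : ∀ {p} → p < N → label (suc N) p (suc N) ≡ 𝑥
  label-new-𝑥 p<N = trans (label-below (suc N) (ℕₚ.<⇒≢ (ℕₚ.m<n⇒m<1+n p<N)))
                          (cong suc (gapLabel-𝑥 (ℕₚ.m<n⇒m<1+n p<N) (ℕₚ.<⇒≢ p<N ∘ ℕₚ.suc-injective)))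

  label-new-𝑧 : label (suc N) N (suc N) ≡ 𝑧
  label-new-𝑧 = trans (label-below (suc N) (ℕₚ.<⇒≢ (ℕₚ.n<1+n N))) (cong suc (gapLabel-𝑧 1≤N))

  label-new-𝑦 : ∀ {q} → q < N → label (suc N) N q ≡ 𝑦
  label-new-𝑦 {q} q<N = trans (label-below q (ℕₚ.<⇒≢ (ℕₚ.n<1+n N))) (cong suc (gapLabel-𝑦 (ℕₚ.<⇒≤ q<N)))

  gapsFrom-new : ∀ {ys} → All (_< N) ys → gapsFrom (suc N) ys ≡ gapsFrom N ys
  gapsFrom-new []                 = refl
  gapsFrom-new {q ∷ ys} (q<N ∷ a) = cong₂ _∷_ (label-new-below (head₀ ys) q<N) (gapsFrom-new a)

  -- The old maximum N loses its label 𝑎 and becomes a descent 𝑦.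
  gapsFrom-new-weight : ∀ {ys} → UniqueMax N ys →
                        count (gapsFrom (suc N) ys) ⊕ 𝟙 𝑎 ≡ count (gapsFrom N ys) ⊕ 𝟙 𝑦
  gapsFrom-new-weight {N ∷ ys} (here a) = begin
    (𝟙 (label (suc N) N (head₀ ys)) ⊕ count (gapsFrom (suc N) ys)) ⊕ 𝟙 𝑎
      ≡⟨ cong₂ (λ i G → (𝟙 i ⊕ count G) ⊕ 𝟙 𝑎) (label-new-𝑦 (head₀-< 1≤N a)) (gapsFrom-new a) ⟩
    (𝟙 𝑦 ⊕ count (gapsFrom N ys)) ⊕ 𝟙 𝑎
      ≡⟨ ⊕-shift (count (gapsFrom N ys)) (⊕.comm (𝟙 𝑦) (𝟙 𝑎)) ⟩
    (𝟙 𝑎 ⊕ count (gapsFrom N ys)) ⊕ 𝟙 𝑦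
      ≡⟨ cong (λ i → (𝟙 i ⊕ count (gapsFrom N ys)) ⊕ 𝟙 𝑦) (label-max N (head₀ ys)) ⟨
    (𝟙 (label N N (head₀ ys)) ⊕ count (gapsFrom N ys)) ⊕ 𝟙 𝑦 ∎
    where open ≡-Reasoning
  gapsFrom-new-weight {q ∷ ys} (there q<N u) = begin
    (𝟙 (label (suc N) q (head₀ ys)) ⊕ count (gapsFrom (suc N) ys)) ⊕ 𝟙 𝑎
      ≡⟨ cong (λ i → (𝟙 i ⊕ _) ⊕ 𝟙 𝑎) (label-new-below (head₀ ys) q<N) ⟩
    (𝟙 (label N q (head₀ ys)) ⊕ count (gapsFrom (suc N) ys)) ⊕ 𝟙 𝑎
      ≡⟨ ⊕.assoc _ _ _ ⟩
    𝟙 (label N q (head₀ ys)) ⊕ count (gapsFrom (suc N) ys) ⊕ 𝟙 𝑎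
      ≡⟨ cong (𝟙 (label N q (head₀ ys)) ⊕_) (gapsFrom-new-weight u) ⟩
    𝟙 (label N q (head₀ ys)) ⊕ count (gapsFrom N ys) ⊕ 𝟙 𝑦
      ≡⟨ ⊕.assoc _ _ _ ⟨
    (𝟙 (label N q (head₀ ys)) ⊕ count (gapsFrom N ys)) ⊕ 𝟙 𝑦 ∎
    where open ≡-Reasoning

  insert-after-below : ∀ {v v′} p ys → p < N →
    (v ⊕ count (gapsFrom (suc N) ys)) ⊕ 𝟙 𝑎 ≡ (v′ ⊕ count (gapsFrom N ys)) ⊕ 𝟙 𝑦 →
    v ⊕ count (gaps (suc N) p (suc N ∷ ys)) ≡ leibniz (v′ ⊕ count (gaps N p ys)) (label N p (head₀ ys))
  insert-after-below {v} {v′} p ys p<N shifted = begin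
    v ⊕ 𝟙 (label (suc N) p (suc N)) ⊕ 𝟙 (label (suc N) (suc N) (head₀ ys)) ⊕ R
      ≡⟨ cong₂ (λ i j → v ⊕ 𝟙 i ⊕ 𝟙 j ⊕ R) (label-new-𝑥 p<N) (label-max (suc N) (head₀ ys)) ⟩
    v ⊕ 𝟙 𝑥 ⊕ 𝟙 𝑎 ⊕ R
      ≡⟨ solve 4 (λ v x a r → v ⊕ᵉ x ⊕ᵉ a ⊕ᵉ r ⊜ x ⊕ᵉ (v ⊕ᵉ r) ⊕ᵉ a) refl v (𝟙 𝑥) (𝟙 𝑎) R ⟩
    𝟙 𝑥 ⊕ (v ⊕ R) ⊕ 𝟙 𝑎
      ≡⟨ cong (𝟙 𝑥 ⊕_) shifted ⟩
    𝟙 𝑥 ⊕ (v′ ⊕ R′) ⊕ 𝟙 𝑦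
      ≡⟨ solve 4 (λ x u r y → x ⊕ᵉ (u ⊕ᵉ r) ⊕ᵉ y ⊜ (u ⊕ᵉ r) ⊕ᵉ (x ⊕ᵉ y)) refl (𝟙 𝑥) v′ R′ (𝟙 𝑦) ⟩
    (v′ ⊕ R′) ⊕ Dexp (suc (gapLabel p (head₀ ys)))
      ≡⟨ cong (λ i → (v′ ⊕ R′) ⊕ Dexp i) (label-below (head₀ ys) (ℕₚ.<⇒≢ p<N)) ⟨
    (v′ ⊕ R′) ⊕ Dexp (label N p (head₀ ys))
      ≡⟨ leibniz-𝟙⊕ v′ (label N p (head₀ ys)) R′ ⟨
    leibniz (v′ ⊕ 𝟙 (label N p (head₀ ys)) ⊕ R′) (label N p (head₀ ys)) ∎
    where
    open ≡-Reasoning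
    R R′ : Mono 5
    R  = count (gapsFrom (suc N) ys)
    R′ = count (gapsFrom N ys)

  insert-after-max : ∀ {v} ys → All (_< N) ys →
    v ⊕ count (gaps (suc N) N (suc N ∷ ys)) ≡ leibniz (v ⊕ count (gaps N N ys)) (label N N (head₀ ys))
  insert-after-max {v} ys a = begin
    v ⊕ 𝟙 (label (suc N) N (suc N)) ⊕ 𝟙 (label (suc N) (suc N) (head₀ ys)) ⊕ count (gapsFrom (suc N) ys)
      ≡⟨ cong₂ (λ i j → v ⊕ 𝟙 i ⊕ 𝟙 j ⊕ count (gapsFrom (suc N) ys))
               label-new-𝑧 (label-max (suc N) (head₀ ys)) ⟩
    v ⊕ 𝟙 𝑧 ⊕ 𝟙 𝑎 ⊕ count (gapsFrom (suc N) ys)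
      ≡⟨ cong (λ G → v ⊕ 𝟙 𝑧 ⊕ 𝟙 𝑎 ⊕ count G) (gapsFrom-new a) ⟩
    v ⊕ 𝟙 𝑧 ⊕ 𝟙 𝑎 ⊕ R′
      ≡⟨ solve 4 (λ v z a r → v ⊕ᵉ z ⊕ᵉ a ⊕ᵉ r ⊜ (v ⊕ᵉ r) ⊕ᵉ (a ⊕ᵉ z)) refl v (𝟙 𝑧) (𝟙 𝑎) R′ ⟩
    (v ⊕ R′) ⊕ Dexp 𝑎
      ≡⟨ leibniz-𝟙⊕ v 𝑎 R′ ⟨
    leibniz (v ⊕ 𝟙 𝑎 ⊕ R′) 𝑎
      ≡⟨ cong (λ i → leibniz (v ⊕ 𝟙 i ⊕ R′) i) (label-max N (head₀ ys)) ⟨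
    leibniz (v ⊕ 𝟙 (label N N (head₀ ys)) ⊕ R′) (label N N (head₀ ys)) ∎
    where
    open ≡-Reasoning
    R′ : Mono 5
    R′ = count (gapsFrom N ys)

  insertions-tail : ∀ {v v′ i j} p y ys → label (suc N) p y ≡ i → label N p y ≡ j →
    map (λ τ → (v ⊕ 𝟙 i) ⊕ count (gaps (suc N) y τ)) (insertions (suc N) ys)
      ≡ map (leibniz ((v′ ⊕ 𝟙 j) ⊕ count (gaps N y ys))) (gaps N y ys) →
    map (λ τ → v ⊕ count (gaps (suc N) p τ)) (map (y ∷_) (insertions (suc N) ys))
      ≡ map (leibniz (v′ ⊕ count (gaps N p (y ∷ ys)))) (gaps N y ys)
  insertions-tail {v} {v′} {i} {j} p y ys label≡i label≡j ih = begin
    map (λ τ → v ⊕ count (gaps (suc N) p τ)) (map (y ∷_) (insertions (suc N) ys))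
      ≡⟨ Listₚ.map-∘ (insertions (suc N) ys) ⟨
    map (λ τ → v ⊕ 𝟙 (label (suc N) p y) ⊕ count (gaps (suc N) y τ)) (insertions (suc N) ys)
      ≡⟨ Listₚ.map-cong (λ τ → trans (cong (λ i → v ⊕ 𝟙 i ⊕ _) label≡i) (sym (⊕.assoc v (𝟙 i) _)))
                        (insertions (suc N) ys) ⟩
    map (λ τ → (v ⊕ 𝟙 i) ⊕ count (gaps (suc N) y τ)) (insertions (suc N) ys)
      ≡⟨ ih ⟩
    map (leibniz ((v′ ⊕ 𝟙 j) ⊕ count (gaps N y ys))) (gaps N y ys)
      ≡⟨ cong (λ u → map (leibniz u) (gaps N y ys))
              (trans (⊕.assoc v′ (𝟙 j) _) (cong (λ i → v′ ⊕ 𝟙 i ⊕ _) (sym label≡j))) ⟩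
    map (leibniz (v′ ⊕ count (gaps N p (y ∷ ys)))) (gaps N y ys) ∎
    where open ≡-Reasoning

  shifted-past-max : ∀ {v v′} ys → All (_< N) ys → v ⊕ 𝟙 𝑎 ≡ v′ ⊕ 𝟙 𝑦 →
    (v ⊕ count (gapsFrom (suc N) ys)) ⊕ 𝟙 𝑎 ≡ (v′ ⊕ count (gapsFrom N ys)) ⊕ 𝟙 𝑦
  shifted-past-max {v′ = v′} ys a shifted =
    trans (⊕-shift (count (gapsFrom (suc N) ys)) shifted) (cong (λ G → (v′ ⊕ count G) ⊕ 𝟙 𝑦) (gapsFrom-new a))

  -- Past the old maximum, the prefix weights v with and v′ without suc N differ by 𝑎 versus 𝑦.
  insertions-past-max : ∀ {v v′} q zs → q < N → All (_< N) zs → v ⊕ 𝟙 𝑎 ≡ v′ ⊕ 𝟙 𝑦 →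
    map (λ τ → v ⊕ count (gaps (suc N) q τ)) (insertions (suc N) zs)
      ≡ map (leibniz (v′ ⊕ count (gaps N q zs))) (gaps N q zs)
  insertions-past-max q [] q<N [] shifted =
    cong (_∷ []) (insert-after-below q [] q<N (shifted-past-max [] [] shifted))
  insertions-past-max q (y ∷ zs) q<N (y<N ∷ a) shifted =
    cong₂ _∷_ (insert-after-below q (y ∷ zs) q<N (shifted-past-max (y ∷ zs) (y<N ∷ a) shifted))
      (insertions-tail q y zs (label-new-below y q<N) refl
        (insertions-past-max y zs y<N a (⊕-shift (𝟙 (label N q y)) shifted)))

  -- Inserting suc N into the successive gaps of p ys gives, gap by gap, the Leibniz terms of D at
  -- the labels gaps N p ys; v is the weight of the letters before p.
  insertions-before-max : ∀ v p ys → UniqueMax N (p ∷ ys) →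
    map (λ τ → v ⊕ count (gaps (suc N) p τ)) (insertions (suc N) ys)
      ≡ map (leibniz (v ⊕ count (gaps N p ys))) (gaps N p ys)
  insertions-before-max v .N [] (here []) = cong (_∷ []) (insert-after-max [] [])
  insertions-before-max v .N (y ∷ ys) (here (y<N ∷ a)) =
    cong₂ _∷_ (insert-after-max (y ∷ ys) (y<N ∷ a))
      (insertions-tail N y ys (label-new-𝑦 y<N) (label-max N y)
        (insertions-past-max y ys y<N a (xy∙z≈xz∙y v (𝟙 𝑦) (𝟙 𝑎))))
  insertions-before-max v p (y ∷ ys) (there p<N u) =
    cong₂ _∷_ (insert-after-below p (y ∷ ys) p<N shifted)
      (insertions-tail p y ys (label-new-below y p<N) refl
        (insertions-before-max (v ⊕ 𝟙 (label N p y)) y ys u))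
    where
    shifted = trans (⊕.assoc v _ (𝟙 𝑎))
                    (trans (cong (v ⊕_) (gapsFrom-new-weight u)) (sym (⊕.assoc v _ (𝟙 𝑦))))

  ∑-insertions : ∀ H σ → UniqueMax N σ →
                 ∑ (H ∘ weight (suc N)) (insertions (suc N) σ) ≡ derivᵀ Dgen H (weight N σ)
  ∑-insertions H σ u = begin
    ∑ (H ∘ weight (suc N)) (insertions (suc N) σ)
      ≡⟨ ∑-map H (weight (suc N)) (insertions (suc N) σ) ⟨
    ∑ H (map (weight (suc N)) (insertions (suc N) σ))
      ≡⟨ cong (∑ H) (Listₚ.map-cong (λ τ → ⊕.identityˡ (weight (suc N) τ)) (insertions (suc N) σ)) ⟨
    ∑ H (map (λ τ → 0ᵐ ⊕ weight (suc N) τ) (insertions (suc N) σ))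
      ≡⟨ cong (∑ H) (insertions-before-max 0ᵐ 0 σ (there 1≤N u)) ⟩
    ∑ H (map (leibniz (0ᵐ ⊕ weight N σ)) (gaps N 0 σ))
      ≡⟨ cong (λ w → ∑ H (map (leibniz w) (gaps N 0 σ))) (⊕.identityˡ (weight N σ)) ⟩
    ∑ H (map (leibniz (weight N σ)) (gaps N 0 σ))
      ≡⟨ ∑-map H (leibniz (weight N σ)) (gaps N 0 σ) ⟩
    ∑ (H ∘ leibniz (weight N σ)) (gaps N 0 σ)
      ≡⟨ derivᵀ-count Dgen-isMonomial H (gaps N 0 σ) ⟨
    derivᵀ Dgen H (weight N σ) ∎
    where open ≡-Reasoning

UniqueMax-bounded : ∀ {N σ} → UniqueMax N σ → All (_≤ N) σ
UniqueMax-bounded (here a)      = ℕₚ.≤-refl ∷ All.map ℕₚ.<⇒≤ a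
UniqueMax-bounded (there y<N u) = ℕₚ.<⇒≤ y<N ∷ UniqueMax-bounded u

insertions-UniqueMax : ∀ {M σ} → All (_< M) σ → All (UniqueMax M) (insertions M σ)
insertions-UniqueMax []        = here [] ∷ []
insertions-UniqueMax (y<M ∷ a) =
  here (y<M ∷ a) ∷ Allₚ.map⁺ (All.map (there y<M) (insertions-UniqueMax a))

insertions-All : ∀ {P : ℕ → Set} {x σ} → P x → All P σ → All (All P) (insertions x σ)
insertions-All px []        = (px ∷ []) ∷ []
insertions-All px (py ∷ pσ) =
  (px ∷ py ∷ pσ) ∷ Allₚ.map⁺ (All.map (py ∷_) (insertions-All px pσ))

S-UniqueMax : ∀ n → All (UniqueMax (suc n)) (S (suc n))
S-UniqueMax zero    = here [] ∷ []
S-UniqueMax (suc n) =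
  Allₚ.concat⁺ (Allₚ.map⁺ (All.map (insertions-UniqueMax ∘ All.map s≤s ∘ UniqueMax-bounded) (S-UniqueMax n)))

S-positive : ∀ n → All (All (0 <_)) (S n)
S-positive zero    = [] ∷ []
S-positive (suc n) = Allₚ.concat⁺ (Allₚ.map⁺ (All.map (insertions-All (s≤s z≤n)) (S-positive n)))

∑-weight-S : ∀ n H → ∑ (H ∘ weight (suc n)) (S (suc n)) ≡ iterateᵀ Dgen n H (𝟙 𝑎 ⊕ 𝟙 𝑏)
∑-weight-S zero    H = ℚₚ.+-identityʳ _
∑-weight-S (suc n) H = begin
  ∑ (H ∘ weight (suc (suc n))) (S (suc (suc n)))
    ≡⟨ ∑-concatMap (H ∘ weight (suc (suc n))) (insertions (suc (suc n))) (S (suc n)) ⟩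
  ∑ (∑ (H ∘ weight (suc (suc n))) ∘ insertions (suc (suc n))) (S (suc n))
    ≡⟨ ∑-cong-All (All.map (InsertMax.∑-insertions (suc n) (s≤s z≤n) H _) (S-UniqueMax n)) ⟩
  ∑ (derivᵀ Dgen H ∘ weight (suc n)) (S (suc n))
    ≡⟨ ∑-weight-S n (derivᵀ Dgen H) ⟩
  iterateᵀ Dgen n (derivᵀ Dgen H) (𝟙 𝑎 ⊕ 𝟙 𝑏) ∎
  where open ≡-Reasoning

-- Ascents and successions

ascents successions : Mono 5 → ℕ
ascents w     = lookup w 𝑏 ℕ.+ lookup w 𝑥 ℕ.+ lookup w 𝑧
successions w = lookup w 𝑧

ascents-gapLabel : ∀ p q → ascents (𝟙 (suc (gapLabel p q))) ≡ (if does (p <? q) then 1 else 0)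
ascents-gapLabel p q with p <? q
... | no p≮q rewrite gapLabel-𝑦 (ℕₚ.≮⇒≥ p≮q) | dec-false (p <? q) p≮q = refl
... | yes p<q with suc p ≟ q
...   | no 1+p≢q rewrite gapLabel-𝑥 p<q 1+p≢q | dec-true (p <? q) p<q = refl
...   | yes refl with p ≟ 0
...     | yes refl = refl
...     | no p≢0 rewrite gapLabel-𝑧 (ℕₚ.n≢0⇒n>0 p≢0) | dec-true (p <? suc p) p<q = refl

successions-gapLabel : ∀ {p} q → 0 < p →
                       successions (𝟙 (suc (gapLabel p q))) ≡ (if does (suc p ≟ q) then 1 else 0)
successions-gapLabel {p} q 0<p with suc p ≟ q
... | yes refl rewrite gapLabel-𝑧 0<p | dec-true (suc p ≟ suc p) refl = refl
... | no 1+p≢q with p <? q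
...   | yes p<q rewrite gapLabel-𝑥 p<q 1+p≢q | dec-false (suc p ≟ q) 1+p≢q = refl
...   | no p≮q  rewrite gapLabel-𝑦 (ℕₚ.≮⇒≥ p≮q) | dec-false (suc p ≟ q) 1+p≢q = refl

successions-gapLabel-0 : ∀ q → successions (𝟙 (suc (gapLabel 0 q))) ≡ 0
successions-gapLabel-0 0             = refl
successions-gapLabel-0 1             = refl
successions-gapLabel-0 (suc (suc q)) = refl

ascents-label : ∀ {M} p q → q ≤ M → ascents (𝟙 (label M p q)) ≡ (if does (p <? q) then 1 else 0)
ascents-label {M} p q q≤M with p ≟ M
... | yes refl rewrite label-max p q | dec-false (p <? q) (ℕₚ.≤⇒≯ q≤M) = refl
... | no p≢M   rewrite label-below q p≢M = ascents-gapLabel p q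

successions-label : ∀ {M} p q → 0 < p → q ≤ M →
                    successions (𝟙 (label M p q)) ≡ (if does (suc p ≟ q) then 1 else 0)
successions-label {M} p q 0<p q≤M with p ≟ M
... | yes refl rewrite label-max p q | dec-false (suc p ≟ q) (λ e → ℕₚ.<⇒≱ (ℕₚ.≤-reflexive e) q≤M) = refl
... | no p≢M   rewrite label-below q p≢M = successions-gapLabel q 0<p

ascents-⊕ : ∀ u w → ascents (u ⊕ w) ≡ ascents u ℕ.+ ascents w
ascents-⊕ (_ ∷ u₁ ∷ u₂ ∷ _ ∷ u₄ ∷ []) (_ ∷ w₁ ∷ w₂ ∷ _ ∷ w₄ ∷ []) = interchange u₁ u₂ u₄ w₁ w₂ w₄
  where
  interchange : ∀ a b c d e f → a ℕ.+ d ℕ.+ (b ℕ.+ e) ℕ.+ (c ℕ.+ f) ≡ a ℕ.+ b ℕ.+ c ℕ.+ (d ℕ.+ e ℕ.+ f)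
  interchange = ℕSolver.solve-∀

successions-⊕ : ∀ u w → successions (u ⊕ w) ≡ successions u ℕ.+ successions w
successions-⊕ u w = Vecₚ.lookup-zipWith ℕ._+_ 𝑧 u w

countAsc-gaps : ∀ {M} p qs → All (_≤ M) qs → countAsc qs p ≡ ascents (count (gaps M p qs))
countAsc-gaps {M} p []       []          =
  sym (trans (ascents-⊕ (𝟙 (label M p 0)) 0ᵐ) (trans (ℕₚ.+-identityʳ _) (ascents-label p 0 z≤n)))
countAsc-gaps {M} p (q ∷ qs) (q≤M ∷ a) =
  sym (trans (ascents-⊕ (𝟙 (label M p q)) _)
             (cong₂ ℕ._+_ (ascents-label p q q≤M) (sym (countAsc-gaps q qs a))))

countSuc-gaps : ∀ {M} p qs → 0 < p → All (0 <_) qs → All (_≤ M) qs →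
                countSuc qs p ≡ successions (count (gaps M p qs))
countSuc-gaps {M} p []       0<p []            []          =
  sym (trans (successions-⊕ (𝟙 (label M p 0)) 0ᵐ) (trans (ℕₚ.+-identityʳ _) (successions-label p 0 0<p z≤n)))
countSuc-gaps {M} p (q ∷ qs) 0<p (0<q ∷ pos) (q≤M ∷ a) =
  sym (trans (successions-⊕ (𝟙 (label M p q)) _)
             (cong₂ ℕ._+_ (successions-label p q 0<p q≤M) (sym (countSuc-gaps q qs 0<q pos a))))

asc-weight : ∀ {N σ} → All (_≤ N) σ → asc σ ≡ ascents (weight N σ)
asc-weight {σ = σ} = countAsc-gaps 0 σ

-- The initial gap 0 σ₁ is never a succession: it is labelled 𝑏 when σ₁ = 1.
sucs-weight : ∀ {N} σ → 0 < N → All (0 <_) σ → All (_≤ N) σ → sucs σ ≡ successions (weight N σ)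
sucs-weight {N} σ 0<N pos bounded = begin
  sucs σ
    ≡⟨ sucs-gaps σ pos bounded ⟩
  successions (count (gapsFrom N σ))
    ≡⟨ cong (ℕ._+ successions (count (gapsFrom N σ))) first-gap ⟨
  successions (𝟙 (label N 0 (head₀ σ))) ℕ.+ successions (count (gapsFrom N σ))
    ≡⟨ successions-⊕ (𝟙 (label N 0 (head₀ σ))) _ ⟨
  successions (weight N σ) ∎
  where
  open ≡-Reasoning
  first-gap : successions (𝟙 (label N 0 (head₀ σ))) ≡ 0
  first-gap = trans (cong (successions ∘ 𝟙) (label-below (head₀ σ) (ℕₚ.<⇒≢ 0<N)))
                    (successions-gapLabel-0 (head₀ σ))
  sucs-gaps : ∀ σ → All (0 <_) σ → All (_≤ N) σ → sucs σ ≡ successions (count (gapsFrom N σ))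
  sucs-gaps []       []          []            = refl
  sucs-gaps (y ∷ ys) (0<y ∷ pos) (_ ∷ bounded) = countSuc-gaps y ys 0<y pos bounded

specialiseExp : Fin 5 → Mono 2
specialiseExp 𝑎 = 0ᵐ
specialiseExp 𝑏 = 𝟙 0F
specialiseExp 𝑥 = 𝟙 0F
specialiseExp 𝑦 = 0ᵐ
specialiseExp 𝑧 = 𝟙 0F ⊕ 𝟙 1F

specialise-isMonomial : ∀ i → IsMonomial (specialise i) (specialiseExp i)
specialise-isMonomial 𝑎 = monoP-isMonomial 0ᵐ
specialise-isMonomial 𝑏 = varP-isMonomial 0F
specialise-isMonomial 𝑥 = varP-isMonomial 0F
specialise-isMonomial 𝑦 = monoP-isMonomial 0ᵐ
specialise-isMonomial 𝑧 = *P-isMonomial (varP-isMonomial 0F) (varP-isMonomial 1F)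

×ᵐ-pair : ∀ n a b → n ×ᵐ (a ∷ b ∷ []) ≡ n ℕ.* a ∷ n ℕ.* b ∷ []
×ᵐ-pair zero    a b = refl
×ᵐ-pair (suc n) a b = cong ((a ∷ b ∷ []) ⊕_) (×ᵐ-pair n a b)

substExp-specialise : ∀ w → substExp specialiseExp w ≡ ascents w ∷ successions w ∷ []
substExp-specialise (w₀ ∷ w₁ ∷ w₂ ∷ w₃ ∷ w₄ ∷ [])
  rewrite ×ᵐ-pair w₀ 0 0 | ×ᵐ-pair w₁ 1 0 | ×ᵐ-pair w₂ 1 0 | ×ᵐ-pair w₃ 0 0 | ×ᵐ-pair w₄ 1 1 =
  cong₂ (λ a s → a ∷ s ∷ []) (x-degree w₀ w₁ w₂ w₃ w₄) (z-degree w₀ w₁ w₂ w₃ w₄)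
  where
  x-degree : ∀ a b x y z → a ℕ.* 0 ℕ.+ (b ℕ.* 1 ℕ.+ (x ℕ.* 1 ℕ.+ (y ℕ.* 0 ℕ.+ (z ℕ.* 1 ℕ.+ 0))))
                           ≡ b ℕ.+ x ℕ.+ z
  x-degree = ℕSolver.solve-∀
  z-degree : ∀ a b x y z → a ℕ.* 0 ℕ.+ (b ℕ.* 0 ℕ.+ (x ℕ.* 0 ℕ.+ (y ℕ.* 0 ℕ.+ (z ℕ.* 1 ℕ.+ 0)))) ≡ z
  z-degree = ℕSolver.solve-∀

⟨δ⟩-specialise : ∀ m w → ⟨ δ m ⟩ (substMono specialise w) ≡ δ m (ascents w ∷ successions w ∷ [])
⟨δ⟩-specialise m w =
  trans (⟨⟩-eval (substMono-isMonomial specialise-isMonomial w) (δ m)) (cong (δ m) (substExp-specialise w))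

corollary3p8 : (n : ℕ) → 1 ≤ n → (m : Mono 2) →
    coeff (Pn n) m ≡ coeff (substP specialise (iterateP D (n ∸ 1) (vA *P vB))) m
corollary3p8 (suc k) _ m = begin
  coeff (Pn (suc k)) m                                   ≡⟨ coeff≡⟨δ⟩ (Pn (suc k)) m ⟩
  ⟨ δ m ⟩ (Pn (suc k))                                   ≡⟨ ∑-map _ _ (S (suc k)) ⟩
  ∑ (λ σ → 1ℚ * δ m (asc σ ∷ sucs σ ∷ [])) (S (suc k))
    ≡⟨ ∑-cong-All (All.zipWith statistics (S-UniqueMax k , S-positive (suc k))) ⟩
  ∑ (H ∘ weight (suc k)) (S (suc k))                     ≡⟨ ∑-weight-S k H ⟩
  iterateᵀ Dgen k H (𝟙 𝑎 ⊕ 𝟙 𝑏)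
    ≡⟨ ⟨⟩-eval (*P-isMonomial (varP-isMonomial 𝑎) (varP-isMonomial 𝑏)) (iterateᵀ Dgen k H) ⟨
  ⟨ iterateᵀ Dgen k H ⟩ (vA *P vB)                       ≡⟨ ⟨⟩-iterateP Dgen k H (vA *P vB) ⟨
  ⟨ H ⟩ p₀                                               ≡⟨ ⟨⟩-extend (δ m) (substMono specialise) _ (λ _ _ → refl) p₀ ⟨
  ⟨ δ m ⟩ (substP specialise p₀)                         ≡⟨ coeff≡⟨δ⟩ (substP specialise p₀) m ⟨
  coeff (substP specialise p₀) m                         ∎
  where
  open ≡-Reasoning
  p₀ : Poly 5
  p₀ = iterateP D k (vA *P vB)
  H : Mono 5 → ℚ
  H w = ⟨ δ m ⟩ (substMono specialise w)
  statistics : ∀ {σ} → UniqueMax (suc k) σ × All (0 <_) σ →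
               1ℚ * δ m (asc σ ∷ sucs σ ∷ []) ≡ H (weight (suc k) σ)
  statistics {σ} (u , pos) = begin
    1ℚ * δ m (asc σ ∷ sucs σ ∷ [])                   ≡⟨ ℚₚ.*-identityˡ _ ⟩
    δ m (asc σ ∷ sucs σ ∷ [])
      ≡⟨ cong₂ (λ a s → δ m (a ∷ s ∷ [])) (asc-weight bounded) (sucs-weight σ (s≤s z≤n) pos bounded) ⟩
    δ m (ascents w ∷ successions w ∷ [])             ≡⟨ ⟨δ⟩-specialise m w ⟨
    H w                                              ∎
    where
    w = weight (suc k) σ
    bounded = UniqueMax-bounded u
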